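{- Let $F\colon\mathbb{F}_2^n\to\mathbb{F}_2^n$ be shift-invariant, i.e., $F\circ S=S\circ F$. Then $F$ is bijective if and only if for every cycle $X$ the image $F(X)$ is a cycle, and for every $\ell$ the map $c_\ell\to c_\ell$, $X\mapsto F(X)$, is well defined (i.e., $F(X)\in c_\ell$ for $X\in c_\ell$) and is a bijection of $c_\ell$.
   Context: $S\colon\mathbb{F}_2^n\to\mathbb{F}_2^n$ is the right cyclic shift $S(x_1,\dotsc,x_n)=(x_n,x_1,\dotsc,x_{n-1})$. The cycle of $x\in\mathbb{F}_2^n$ is $c(x)=\{S^i(x): i=0,\dots,n-1\}$; its size is its length. A cycle is any set of the form $c(x)$. For each $\ell$, $c_\ell$ denotes the set of all cycles of length $\ell$. -}

module Defs where

open import Data.Bool using (Bool)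
open import Data.Nat using (ℕ; zero; suc; _<_)
open import Data.Vec using (Vec; []; _∷_; last; init)
open import Data.List using (List; length)
open import Data.List.Relation.Unary.Unique.Propositional using (Unique)
import Data.List.Membership.Propositional as LMem
open import Data.Product using (Σ; ∃; _×_; _,_)
open import Function using (_∘_)
open import Relation.Binary.PropositionalEquality using (_≡_)
open import Level using (0ℓ; suc)

-- F₂ is represented by Bool; F₂ⁿ by Vec Bool n.
Word : ℕ → Set
Word n = Vec Bool n

S : ∀ {n} → Word n → Word n
S {zero}  []      = []
S {suc n} v@(_ ∷ _) = last v ∷ init v

S^ : ∀ {n} → ℕ → Word n → Word n
S^ zero    x = x
S^ (suc i) x = S (S^ i x)

Subset : ℕ → Set₁
Subset n = Word n → Set

_≐_ : ∀ {n} → Subset n → Subset n → Set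
X ≐ Y = ∀ z → (X z → Y z) × (Y z → X z)

cyc : ∀ {n} → Word n → Subset n
cyc {n} x z = Σ ℕ λ i → i < n × z ≡ S^ i x

image : ∀ {n} → (Word n → Word n) → Subset n → Subset n
image F X y = Σ (Word _) λ x → X x × F x ≡ y

IsCycle : ∀ {n} → Subset n → Set
IsCycle {n} X = Σ (Word n) λ x → X ≐ cyc x

HasSize : ∀ {n} → ℕ → Subset n → Set
HasSize {n} ℓ X = Σ (List (Word n)) λ xs →
  Unique xs × length xs ≡ ℓ × (∀ z → (X z → z LMem.∈ xs) × (z LMem.∈ xs → X z))

InC : ∀ {n} → ℕ → Subset n → Set
InC ℓ X = IsCycle X × HasSize ℓ X

-- X ↦ F(X) is a well-defined map c_ℓ → c_ℓ and is a bijection of c_ℓ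
-- (cycles compared as sets, i.e. up to ≐)
BijectionOnC : ∀ {n} → (Word n → Word n) → ℕ → Set₁
BijectionOnC {n} F ℓ =
    (∀ X → InC ℓ X → InC ℓ (image F X))
  × (∀ X Y → InC ℓ X → InC ℓ Y → image F X ≐ image F Y → X ≐ Y)
  × (∀ Y → InC ℓ Y → Σ (Subset n) λ X → InC ℓ X × image F X ≐ Y)

-- A shift-invariant F maps c(x) onto c(F x), since F (S^i x) = S^i (F x).  If F is a
-- bijection, both F and its inverse are injective and shift-invariant, so they map
-- c_ℓ into c_ℓ preserving sizes, and the two maps X ↦ F(X), Y ↦ F⁻¹(Y) are mutually
-- inverse.  Conversely, every y lies on its own cycle c(y) ∈ c_ℓ for some ℓ, so
-- surjectivity of X ↦ F(X) on c_ℓ makes F surjective; a surjective self-map of the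
-- finite set F₂ⁿ is injective.
module Submission where

open import Defs
open import Data.Nat using (ℕ; zero; suc; _+_; _≤_; z≤n; s≤s)
open import Data.Nat.Properties using (+-suc; <-irrefl)
open import Data.Product using (_×_; _,_; proj₁; proj₂; ∃)
open import Data.Sum using (inj₁; inj₂)
open import Data.Bool using (true; false) renaming (_≟_ to _≟ᵇ_)
open import Data.Vec using ([]; _∷_)
open import Data.Vec.Properties using (≡-dec)
open import Data.Fin using (Fin; toℕ; fromℕ<)
open import Data.Fin.Properties using (toℕ<n; toℕ-fromℕ<)
open import Data.List using (List; []; _∷_; [_]; map; _++_; length; allFin; deduplicate)
open import Data.List.Properties using (length-map; length-++)
open import Data.List.Membership.Propositional using (_∈_)
open import Data.List.Membership.Propositional.Properties
  using (∈-∃++; ∈-map⁻; ∈-map⁺; ∈-++⁻; ∈-++⁺ˡ; ∈-++⁺ʳ; ∈-allFin; ∈-deduplicate⁺; ∈-deduplicate⁻)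
open import Data.List.Relation.Binary.Subset.Propositional using (_⊆_)
open import Data.List.Relation.Unary.Any using (here; there)
import Data.List.Relation.Unary.All as All
open import Data.List.Relation.Unary.AllPairs using (_∷_)
open import Data.List.Relation.Unary.Unique.Propositional using (Unique)
import Data.List.Relation.Unary.Unique.Propositional.Properties as Unique
import Data.List.Relation.Unary.Unique.DecPropositional.Properties as DecUnique
open import Relation.Binary.PropositionalEquality
  using (_≡_; _≢_; refl; sym; trans; cong; subst; subst₂; module ≡-Reasoning)
open import Relation.Binary.Definitions using (DecidableEquality)
open import Relation.Nullary using (¬_; yes; no; contradiction)
open import Function.Definitions using (Bijective; Injective; StrictlySurjective)
open import Function.Bundles using (_⇔_; mk⇔)
open import Function.Consequences using (surjective⇒strictlySurjective)
open import Function.Consequences.Propositional using (strictlySurjective⇒surjective)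

module _ {a} {A : Set a} where

  length-++-∷ : ∀ (as : List A) y bs → length (as ++ y ∷ bs) ≡ suc (length (as ++ bs))
  length-++-∷ as y bs = begin
    length (as ++ y ∷ bs)           ≡⟨ length-++ as ⟩
    length as + suc (length bs)     ≡⟨ +-suc (length as) (length bs) ⟩
    suc (length as + length bs)     ≡⟨ cong suc (sym (length-++ as)) ⟩
    suc (length (as ++ bs))         ∎
    where open ≡-Reasoning

  ∈-++-∷⁻ : ∀ {w y : A} (as bs : List A) → w ∈ as ++ y ∷ bs → w ≢ y → w ∈ as ++ bs
  ∈-++-∷⁻ as bs w∈ w≢y with ∈-++⁻ as w∈
  ... | inj₁ w∈as         = ∈-++⁺ˡ w∈as
  ... | inj₂ (here w≡y)   = contradiction w≡y w≢y
  ... | inj₂ (there w∈bs) = ∈-++⁺ʳ as w∈bs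

  Unique⇒length≤ : ∀ {xs ys : List A} → Unique xs → xs ⊆ ys → length xs ≤ length ys
  Unique⇒length≤ {[]}     _              _     = z≤n
  Unique⇒length≤ {x ∷ xs} (x∉xs ∷ uniq) xs⊆ys with ∈-∃++ (xs⊆ys (here refl))
  ... | as , bs , refl rewrite length-++-∷ as x bs =
    s≤s (Unique⇒length≤ uniq λ w∈xs →
      ∈-++-∷⁻ as bs (xs⊆ys (there w∈xs)) λ w≡x → All.lookup x∉xs w∈xs (sym w≡x))

  -- If f x₁ = f b with x₁ ≢ b, all values of f are already hit from the points other than b,
  -- and there are fewer of those than values.
  strictlySurjective⇒injective : DecidableEquality A → (ws : List A) → (∀ x → x ∈ ws) →
    {f : A → A} → StrictlySurjective _≡_ f → Injective _≡_ _≡_ f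
  strictlySurjective⇒injective _≟_ ws complete {f} surj {x₁} {b} fx₁≡fb with x₁ ≟ b
  ... | yes x₁≡b = x₁≡b
  ... | no x₁≢b  with ∈-∃++ (∈-deduplicate⁺ _≟_ (complete b))
  ...   | as , bs , ws′≡ = contradiction (Unique⇒length≤ (DecUnique.deduplicate-! _≟_ ws) cover) too-long
    where
    ws′ = deduplicate _≟_ ws
    others = as ++ bs

    ∈-others : ∀ {x} → x ≢ b → x ∈ others
    ∈-others {x} x≢b = ∈-++-∷⁻ as bs (subst (x ∈_) ws′≡ (∈-deduplicate⁺ _≟_ (complete x))) x≢b

    preimage-in-others : ∀ y → ∃ λ x → x ∈ others × f x ≡ y
    preimage-in-others y with surj y
    ... | x , fx≡y with x ≟ b
    ...   | yes refl = x₁ , ∈-others x₁≢b , trans fx₁≡fb fx≡y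
    ...   | no x≢b   = x , ∈-others x≢b , fx≡y

    cover : ws′ ⊆ map f others
    cover {y} _ with preimage-in-others y
    ... | x , x∈ , fx≡y = subst (_∈ map f others) fx≡y (∈-map⁺ f x∈)

    too-long : ¬ (length ws′ ≤ length (map f others))
    too-long ws′≤ = <-irrefl refl (subst₂ _≤_ (trans (cong length ws′≡) (length-++-∷ as b bs))
                                             (length-map f others) ws′≤)

_≟ʷ_ : ∀ {n} → DecidableEquality (Word n)
_≟ʷ_ = ≡-dec _≟ᵇ_

allWords : ∀ n → List (Word n)
allWords zero    = [ [] ]
allWords (suc n) = map (true ∷_) (allWords n) ++ map (false ∷_) (allWords n)

∈-allWords : ∀ {n} (v : Word n) → v ∈ allWords n
∈-allWords []                  = here refl
∈-allWords (true ∷ v)          = ∈-++⁺ˡ (∈-map⁺ (true ∷_) (∈-allWords v))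
∈-allWords {suc n} (false ∷ v) = ∈-++⁺ʳ (map (true ∷_) (allWords n)) (∈-map⁺ (false ∷_) (∈-allWords v))

Word₀-trivial : (v w : Word 0) → v ≡ w
Word₀-trivial [] [] = refl

ShiftInvariant : ∀ {n} → (Word n → Word n) → Set
ShiftInvariant F = ∀ x → F (S x) ≡ S (F x)

cyc-refl : ∀ {n} (x : Word (suc n)) → cyc x x
cyc-refl x = 0 , s≤s z≤n , refl

module _ {n : ℕ} where

  ≐-refl : {X : Subset n} → X ≐ X
  ≐-refl z = (λ Xz → Xz) , (λ Xz → Xz)

  ≐-sym : {X Y : Subset n} → X ≐ Y → Y ≐ X
  ≐-sym X≐Y z = proj₂ (X≐Y z) , proj₁ (X≐Y z)

  ≐-trans : {X Y Z : Subset n} → X ≐ Y → Y ≐ Z → X ≐ Z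
  ≐-trans X≐Y Y≐Z z = (λ Xz → proj₁ (Y≐Z z) (proj₁ (X≐Y z) Xz))
                    , (λ Zz → proj₂ (X≐Y z) (proj₂ (Y≐Z z) Zz))

  ShiftInvariant⇒S^ : {F : Word n → Word n} → ShiftInvariant F → ∀ i x → F (S^ i x) ≡ S^ i (F x)
  ShiftInvariant⇒S^ inv zero    x = refl
  ShiftInvariant⇒S^ inv (suc i) x = trans (inv (S^ i x)) (cong S (ShiftInvariant⇒S^ inv i x))

  inverse-ShiftInvariant : {F G : Word n → Word n} → Injective _≡_ _≡_ F → (∀ y → F (G y) ≡ y) →
    ShiftInvariant F → ShiftInvariant G
  inverse-ShiftInvariant {F} {G} inj FG inv y = inj (begin
    F (G (S y))   ≡⟨ FG (S y) ⟩
    S y           ≡⟨ cong S (sym (FG y)) ⟩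
    S (F (G y))   ≡⟨ sym (inv (G y)) ⟩
    F (S (G y))   ∎)
    where open ≡-Reasoning

  cyc-HasSize : (x : Word n) → ∃ λ ℓ → HasSize ℓ (cyc x)
  cyc-HasSize x = length orbit , orbit , DecUnique.deduplicate-! _≟ʷ_ shifts , refl , λ z → to z , from z
    where
    shift : Fin n → Word n
    shift i = S^ (toℕ i) x
    shifts = map shift (allFin n)
    orbit = deduplicate _≟ʷ_ shifts

    to : ∀ z → cyc x z → z ∈ orbit
    to z (i , i<n , z≡) = ∈-deduplicate⁺ _≟ʷ_ (subst (_∈ shifts)
      (trans (cong (λ k → S^ k x) (toℕ-fromℕ< i<n)) (sym z≡))
      (∈-map⁺ shift (∈-allFin (fromℕ< i<n))))

    from : ∀ z → z ∈ orbit → cyc x z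
    from z z∈ with ∈-map⁻ shift (∈-deduplicate⁻ _≟ʷ_ shifts z∈)
    ... | j , _ , z≡ = toℕ j , toℕ<n j , z≡

  module _ {F : Word n → Word n} where

    image-resp-≐ : {X Y : Subset n} → X ≐ Y → image F X ≐ image F Y
    image-resp-≐ X≐Y z = (λ (x , Xx , Fx≡z) → x , proj₁ (X≐Y x) Xx , Fx≡z)
                       , (λ (x , Yx , Fx≡z) → x , proj₂ (X≐Y x) Yx , Fx≡z)

    image-cyc : ShiftInvariant F → (x : Word n) → image F (cyc x) ≐ cyc (F x)
    image-cyc inv x z = to , from
      where
      to : image F (cyc x) z → cyc (F x) z
      to (_ , (i , i<n , refl) , refl) = i , i<n , ShiftInvariant⇒S^ inv i x
      from : cyc (F x) z → image F (cyc x) z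
      from (i , i<n , refl) = S^ i x , (i , i<n , refl) , ShiftInvariant⇒S^ inv i x

    image-IsCycle : ShiftInvariant F → (X : Subset n) → IsCycle X → IsCycle (image F X)
    image-IsCycle inv X (x , X≐cx) = F x , ≐-trans (image-resp-≐ X≐cx) (image-cyc inv x)

    image-HasSize : Injective _≡_ _≡_ F → ∀ {ℓ} (X : Subset n) → HasSize ℓ X → HasSize ℓ (image F X)
    image-HasSize inj X (xs , uniq , len , enum) =
      map F xs , Unique.map⁺ inj uniq , trans (length-map F xs) len , λ z → to z , from z
      where
      to : ∀ z → image F X z → z ∈ map F xs
      to z (x , Xx , refl) = ∈-map⁺ F (proj₁ (enum x) Xx)
      from : ∀ z → z ∈ map F xs → image F X z
      from z z∈ with ∈-map⁻ F z∈
      ... | x , x∈ , refl = x , proj₂ (enum x) x∈ , refl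

    image-InC : ShiftInvariant F → Injective _≡_ _≡_ F → ∀ {ℓ} X → InC ℓ X → InC ℓ (image F X)
    image-InC inv inj X (isCyc , size) = image-IsCycle inv X isCyc , image-HasSize inj X size

    image-cancel : Injective _≡_ _≡_ F → {X Y : Subset n} → image F X ≐ image F Y → X ≐ Y
    image-cancel inj FX≐FY z = cancel FX≐FY , cancel (≐-sym FX≐FY)
      where
      cancel : {X Y : Subset n} → image F X ≐ image F Y → X z → Y z
      cancel {Y = Y} FX≐FY Xz with proj₁ (FX≐FY (F z)) (z , Xz , refl)
      ... | w , Yw , Fw≡Fz = subst Y (inj Fw≡Fz) Yw

    image-rightInverse : {G : Word n → Word n} → (∀ y → F (G y) ≡ y) →
      (Y : Subset n) → image F (image G Y) ≐ Y
    image-rightInverse {G} FG Y z = (λ { (_ , (y , Yy , refl) , refl) → subst Y (sym (FG y)) Yy })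
                                  , (λ Yz → G z , (z , Yz , refl) , FG z)

bijective⇒BijectionOnC : ∀ {n} {F : Word n → Word n} →
  ShiftInvariant F → Bijective _≡_ _≡_ F → ∀ ℓ → BijectionOnC F ℓ
bijective⇒BijectionOnC {F = F} inv (inj , surj) ℓ =
    image-InC inv inj
  , (λ _ _ _ _ → image-cancel inj)
  , λ Y Yℓ → image G Y , image-InC {F = G} (inverse-ShiftInvariant inj FG inv) G-inj Y Yℓ
                       , image-rightInverse FG Y
  where
  strict = surjective⇒strictlySurjective _≡_ refl surj
  G = λ y → proj₁ (strict y)
  FG : ∀ y → F (G y) ≡ y
  FG y = proj₂ (strict y)
  G-inj : Injective _≡_ _≡_ G
  G-inj {y₁} {y₂} Gy₁≡Gy₂ = trans (sym (FG y₁)) (trans (cong F Gy₁≡Gy₂) (FG y₂))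

BijectionOnC⇒strictlySurjective : ∀ {n} {F : Word n → Word n} →
  (∀ ℓ → BijectionOnC F ℓ) → StrictlySurjective _≡_ F
BijectionOnC⇒strictlySurjective {zero}  _    y = [] , Word₀-trivial _ y
BijectionOnC⇒strictlySurjective {suc m} onC y with cyc-HasSize y
... | ℓ , size with proj₂ (proj₂ (onC ℓ)) (cyc y) ((y , ≐-refl) , size)
... | X , _ , FX≐cy with proj₂ (FX≐cy y) (cyc-refl y)
... | x , _ , Fx≡y = x , Fx≡y

mainTheorem3 : (n : ℕ) (F : Word n → Word n) →
    (∀ x → F (S x) ≡ S (F x)) →
    Bijective _≡_ _≡_ F ⇔
    ((∀ (X : Subset n) → IsCycle X → IsCycle (image F X))
    × (∀ ℓ → BijectionOnC F ℓ))
mainTheorem3 n F inv = mk⇔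
  (λ bij → image-IsCycle inv , bijective⇒BijectionOnC inv bij)
  (λ (_ , onC) → let surj = BijectionOnC⇒strictlySurjective onC in
      strictlySurjective⇒injective _≟ʷ_ (allWords n) ∈-allWords surj
    , strictlySurjective⇒surjective surj)
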